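{- Let $\mathcal{D}$ be the set of de Polignac numbers, let $k\in\mathbb{N}$, and suppose that $(\mathcal{D},k)$ satisfies the cross product property. Then $\mathcal{D}$ has full asymptotic density in $2\mathbb{N}$; moreover, there is $\kappa<1$ depending on $k$ such that $$\#\{m\in[N]:\ m\text{ even},\ m\notin\mathcal{D}\}\ll N^{\kappa}.$$
   Context: A positive integer $m$ is a de Polignac number if there are infinitely many pairs of primes $(p,p')$ with $p-p'=m$. A finite set of integers is admissible if for every prime $p$ it does not cover all residue classes mod $p$. $(\mathcal{D},k)$ satisfies the cross product property if for every pair of sets $U,V\subset2\mathbb{N}$ with $|U|=|V|=k$, $U\cap V=\emptyset$ and $U\cup V$ admissible, there exists $(u,v)\in U\times V$ with $|u-v|\in\mathcal{D}$. $[N]=\{1,\dots,N\}$ and $2\mathbb{N}$ is the set of positive even integers. -}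

module Defs where

open import Data.Nat using (ℕ; _+_; _*_; _^_; _≤_; _<_; _≥_; ∣_-_∣; NonZero)
open import Data.Nat.DivMod using (_%_)
open import Data.Nat.Divisibility using (_∣_)
open import Data.Nat.Primality using (Prime)
open import Data.Product using (Σ; ∃; ∃-syntax; _×_)
open import Data.List using (List; length; _++_)
open import Data.List.Relation.Unary.All using (All)
open import Data.List.Relation.Unary.Unique.Propositional using (Unique)
open import Data.List.Membership.Propositional using (_∈_)
open import Relation.Binary.PropositionalEquality using (_≡_; _≢_)
open import Relation.Nullary using (¬_)
open import Data.Empty using (⊥)

-- Since p determines p' = p - m, "infinitely
-- many pairs" is expressed as: for every bound n there is such a pair with p ≥ n.
DePolignac : ℕ → Set
DePolignac m = (1 ≤ m) × (∀ (n : ℕ) → ∃[ p ] ∃[ p' ] (n ≤ p × Prime p × Prime p' × p ≡ p' + m))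

PosEven : ℕ → Set
PosEven u = (1 ≤ u) × (2 ∣ u)

Admissible : List ℕ → Set
Admissible S = ∀ (p : ℕ) → (pr : Prime p) →
  ∃[ r ] (r < p × All (λ x → _%_ x p {{Data.Nat.Primality.prime⇒nonZero pr}} ≢ r) S)

Disjoint : List ℕ → List ℕ → Set
Disjoint U V = ∀ x → x ∈ U → x ∈ V → ⊥

CrossProduct : (ℕ → Set) → ℕ → Set
CrossProduct 𝒟 k = ∀ (U V : List ℕ) →
  Unique U → Unique V → length U ≡ k → length V ≡ k →
  All PosEven U → All PosEven V → Disjoint U V → Admissible (U ++ V) →
  ∃[ u ] ∃[ v ] (u ∈ U × v ∈ V × 𝒟 ∣ u - v ∣)

Exceptional : ℕ → ℕ → Set
Exceptional N m = (1 ≤ m) × (m ≤ N) × (2 ∣ m) × ¬ DePolignac m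

-- "Q (#{ m : P m })" for a downward-closed Q, stated without decidability:
-- every duplicate-free list of elements satisfying P has length satisfying Q.
CountSatisfies : (ℕ → Set) → (ℕ → Set) → Set
CountSatisfies P Q = ∀ (xs : List ℕ) → Unique xs → All P xs → Q (length xs)

{-# OPTIONS --safe #-}
module Submission where

open import Defs
open import Data.Nat using (ℕ; _+_; _*_; _^_; _≤_; _<_)
open import Data.Product using (∃-syntax; _×_)

open import Data.Nat
open import Data.Nat.Properties
open import Data.Nat.DivMod using (_%_; _/_; m≡m%n+[m/n]*n; m%n<n; m/n≤m; %-remove-+ˡ)
open import Data.Nat.Divisibility
  using (_∣_; _∣?_; ∣-trans; m∣m*n; ∣m⇒∣m*n; ∣m∣n⇒∣m+n; n∣m⇒m%n≡0; m≤n⇒m!∣n!; %-presˡ-∣)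
open import Data.Nat.Primality using (Prime; prime⇒nonZero; prime⇒nonTrivial)
open import Data.Nat.Tactic.RingSolver using (solve-∀)
open import Data.List using (List; []; _∷_; length; filter; map; concatMap; upTo; take; _++_)
import Data.List.Properties as List
open import Data.List.Relation.Unary.All using (All; []; _∷_)
import Data.List.Relation.Unary.All as All
import Data.List.Relation.Unary.All.Properties as All
open import Data.List.Relation.Unary.Any using (Any; here; there; any?)
import Data.List.Relation.Unary.Any as Any
open import Data.List.Relation.Unary.Unique.Propositional using (Unique)
import Data.List.Relation.Unary.Unique.Propositional.Properties as Unique
import Data.List.Relation.Unary.AllPairs as AllPairs
open import Data.List.Relation.Binary.Sublist.Propositional.Properties
  using (filter-⊆; filter⁺; length-mono-≤)
open import Data.List.Membership.Propositional using (_∈_; _∉_; find)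
open import Data.List.Membership.Propositional.Properties using (∈-map⁻; ∈-filter⁺)
open import Data.Product using (_,_; proj₁; proj₂)
open import Data.Sum using (_⊎_; inj₁; inj₂; [_,_]′)
open import Data.Empty using (⊥; ⊥-elim)
open import Function using (_∘_; id)
open import Relation.Nullary using (Dec; yes; no; ¬_; ¬?; contradiction)
open import Relation.Nullary.Decidable using (decidable-stable)
open import Relation.Unary using (Decidable)
open import Relation.Binary.PropositionalEquality

-- Write K = k + 1 (for k = 0 the cross product property fails outright) and Q = (2K)!.  Some
-- residue class r mod Q holds a 1/Q share of the exceptional numbers in [N]; write them as r + bQ
-- with b ∈ B ⊆ [0, N].  If B contained every difference u − v of two K-element sets U and V,
-- then Q(U + 1) + r and Q(V + 1) would be disjoint sets of positive even numbers whose union is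
-- admissible (a prime p ≤ 2K divides Q, so only the residues 0 and r occur; a larger prime
-- cannot be covered by 2K numbers) and all of whose cross differences are exceptional, against
-- the cross product property.  A greedy Kővári–Sós–Turán argument shows that a set B ⊆ [0, L)
-- without this pattern has |B|^K ≪ L^(K−1): starting from S = [L, 2L), pigeonhole the
-- differences s − b, K times, to find a new v with s − v ∈ B for a share (|B| − K)/2L of S.  Hence
-- the number of exceptional m ≤ N is ≪ N^((K−1)/K), which in particular is o(N).

^-distrib-* : ∀ m n o → (m * n) ^ o ≡ m ^ o * n ^ o
^-distrib-* m n zero    = refl
^-distrib-* m n (suc o) =
  trans (cong (m * n *_) (^-distrib-* m n o)) ([m*n]*[o*p]≡[m*o]*[n*p] m n (m ^ o) (n ^ o))

m+m≡2*m : ∀ m → m + m ≡ 2 * m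
m+m≡2*m = solve-∀

1≤m*n⇒1≤m : ∀ m n → 1 ≤ m * n → 1 ≤ m
1≤m*n⇒1≤m (suc m) n _ = s≤s z≤n

suc-n^k≤2^k*n^k : ∀ n k → 1 ≤ n → suc n ^ k ≤ 2 ^ k * n ^ k
suc-n^k≤2^k*n^k n k 1≤n = begin
  suc n ^ k       ≤⟨ ^-monoˡ-≤ k (≤-trans (≤-reflexive (+-comm 1 n)) (+-monoʳ-≤ n 1≤n)) ⟩
  (n + n) ^ k     ≡⟨ cong (_^ k) (m+m≡2*m n) ⟩
  (2 * n) ^ k     ≡⟨ ^-distrib-* 2 n k ⟩
  2 ^ k * n ^ k   ∎
  where open ≤-Reasoning

power-bound⇒linear-bound : ∀ {k C N} c d → c ^ suc k ≤ C * N ^ k → C * d ^ suc k < N → c * d ≤ N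
power-bound⇒linear-bound {k} {C} {N} c d c^K≤CN^k Cd^K<N with c * d ≤? N
... | yes cd≤N = cd≤N
... | no  cd≰N = contradiction N≤Cd^K (<⇒≱ Cd^K<N)
  where
  instance
    N^k≢0 : NonZero (N ^ k)
    N^k≢0 = m^n≢0 N k {{>-nonZero (≤-<-trans z≤n Cd^K<N)}}
  *-comm-middle : ∀ a b c → a * b * c ≡ a * c * b
  *-comm-middle = solve-∀
  open ≤-Reasoning
  N≤Cd^K : N ≤ C * d ^ suc k
  N≤Cd^K = *-cancelʳ-≤ N (C * d ^ suc k) (N ^ k) (begin
    N ^ suc k               ≤⟨ ^-monoˡ-≤ (suc k) (<⇒≤ (≰⇒> cd≰N)) ⟩
    (c * d) ^ suc k         ≡⟨ ^-distrib-* c d (suc k) ⟩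
    c ^ suc k * d ^ suc k   ≤⟨ *-monoˡ-≤ (d ^ suc k) c^K≤CN^k ⟩
    C * N ^ k * d ^ suc k   ≡⟨ *-comm-middle C (N ^ k) (d ^ suc k) ⟩
    C * d ^ suc k * N ^ k   ∎)

∣n! : ∀ {m n} → 1 ≤ m → m ≤ n → m ∣ n !
∣n! {suc m} _ m≤n = ∣-trans (m∣m*n (m !)) (m≤n⇒m!∣n! m≤n)

module _ {A : Set} where

  fibre : (A → ℕ) → ℕ → List A → List A
  fibre g v = filter (λ x → g x ≟ v)

  module _ {P : A → Set} (P? : Decidable P) where

    length-filter+length-reject : ∀ xs →
      length (filter P? xs) + length (filter (¬? ∘ P?) xs) ≡ length xs
    length-filter+length-reject []       = refl
    length-filter+length-reject (x ∷ xs) with P? x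
    ... | yes _ = cong suc (length-filter+length-reject xs)
    ... | no  _ = trans (+-suc _ _) (cong suc (length-filter+length-reject xs))

    length-filter-filter : ∀ {Q : A → Set} (Q? : Decidable Q) xs →
      length (filter P? (filter Q? xs)) ≤ length (filter P? xs)
    length-filter-filter Q? xs = length-mono-≤ (filter⁺ P? P? (λ { refl p → p }) (filter-⊆ Q? xs))

    length-filter-map : ∀ {B : Set} (f : B → A) xs →
      length (filter P? (map f xs)) ≡ length (filter (P? ∘ f) xs)
    length-filter-map f []       = refl
    length-filter-map f (x ∷ xs) with P? (f x)
    ... | yes _ = cong suc (length-filter-map f xs)
    ... | no  _ = length-filter-map f xs

    length-filter-++ : ∀ xs ys →
      length (filter P? (xs ++ ys)) ≡ length (filter P? xs) + length (filter P? ys)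
    length-filter-++ xs ys = trans (cong length (List.filter-++ P? xs ys)) (List.length-++ (filter P? xs))

  unique∧constant⇒length≤1 : ∀ {c : A} xs → Unique xs → All (_≡ c) xs → length xs ≤ 1
  unique∧constant⇒length≤1 []          _                         _                = z≤n
  unique∧constant⇒length≤1 (_ ∷ [])    _                         _                = ≤-refl
  unique∧constant⇒length≤1 (_ ∷ _ ∷ _) ((x≢y ∷ _) AllPairs.∷ _) (x≡c ∷ y≡c ∷ _) =
    ⊥-elim (x≢y (trans x≡c (sym y≡c)))

  length≤1+length-filter : ∀ {P : A → Set} (P? : Decidable P) {c : A} xs → Unique xs →
    (∀ {x} → ¬ P x → x ≡ c) → length xs ≤ suc (length (filter P? xs))
  length≤1+length-filter P? xs xs! ¬P⇒≡c = begin
    length xs                                            ≡⟨ length-filter+length-reject P? xs ⟨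
    length (filter P? xs) + length (filter (¬? ∘ P?) xs) ≤⟨ +-monoʳ-≤ (length (filter P? xs)) rejected≤1 ⟩
    length (filter P? xs) + 1                            ≡⟨ +-comm _ 1 ⟩
    suc (length (filter P? xs))                          ∎
    where
    open ≤-Reasoning
    rejected≤1 : length (filter (¬? ∘ P?) xs) ≤ 1
    rejected≤1 = unique∧constant⇒length≤1 _ (Unique.filter⁺ (¬? ∘ P?) xs!)
                   (All.map ¬P⇒≡c (All.all-filter (¬? ∘ P?) xs))

  pigeonhole : ∀ (g : A → ℕ) m xs → All (λ x → g x < m) xs →
    ∃[ v ] length xs ≤ m * length (fibre g v xs)
  pigeonhole g zero    []      _        = 0 , z≤n
  pigeonhole g zero    (_ ∷ _) (() ∷ _)
  pigeonhole g (suc m) xs g<1+m with length xs ≤? suc m * length (fibre g m xs)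
  ... | yes ok = m , ok
  ... | no ¬ok = v , (begin
      length xs          ≡⟨ length-filter+length-reject (λ x → g x ≟ m) xs ⟨
      F + length rest    ≤⟨ +-mono-≤ (<⇒≤ F<Fv) rest≤mFv ⟩
      Fv + m * Fv        ∎)
    where
    open ≤-Reasoning
    rest : List A
    rest = filter (¬? ∘ (λ x → g x ≟ m)) xs
    g<m : All (λ x → g x < m) rest
    g<m = All.zipWith (λ (g≢m , g<1+m) → ≤∧≢⇒< (≤-pred g<1+m) g≢m)
            (All.all-filter (¬? ∘ (λ x → g x ≟ m)) xs , All.filter⁺ _ g<1+m)
    popular-in-rest : ∃[ v ] length rest ≤ m * length (fibre g v rest)
    popular-in-rest = pigeonhole g m rest g<m
    v F Fv : ℕ
    v  = proj₁ popular-in-rest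
    F  = length (fibre g m xs)
    Fv = length (fibre g v xs)
    rest≤mFv : length rest ≤ m * Fv
    rest≤mFv = ≤-trans (proj₂ popular-in-rest) (*-monoʳ-≤ m (length-filter-filter (λ x → g x ≟ v) _ xs))
    mF<rest : m * F < length rest
    mF<rest = +-cancelˡ-< F (m * F) (length rest)
      (subst (suc m * F <_) (sym (length-filter+length-reject (λ x → g x ≟ m) xs)) (≰⇒> ¬ok))
    F<Fv : F < Fv
    F<Fv = *-cancelˡ-< m F Fv (<-≤-trans mF<rest rest≤mFv)

-- u − v ∈ B, phrased as u ≡ v + b to avoid truncated subtraction.
_-_∈_ : ℕ → ℕ → List ℕ → Set
u - v ∈ B = Any (λ b → u ≡ v + b) B

_-_∈?_ : ∀ u v B → Dec (u - v ∈ B)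
u - v ∈? B = any? (λ b → u ≟ v + b) B

_⊖_⊆_ : List ℕ → List ℕ → List ℕ → Set
U ⊖ V ⊆ B = All (λ u → All (λ v → u - v ∈ B) V) U

ContainsDifferenceSet : ℕ → List ℕ → Set
ContainsDifferenceSet k B = ∃[ U ] ∃[ V ]
  (Unique U × length U ≡ k × Unique V × length V ≡ k × U ⊖ V ⊆ B)

difference-set-element : ∀ {k B} → ContainsDifferenceSet (suc k) B → ∃[ b ] b ∈ B
difference-set-element (_ ∷ _ , _ ∷ _ , _ , _ , _ , _ , (u-v∈B ∷ _) ∷ _) =
  let b , b∈B , _ = find u-v∈B in b , b∈B

difference-set-constant : ℕ → ℕ
difference-set-constant k = (k + k) ^ k + 2 ^ k * 2 ^ k * k

module DifferenceSet (B : List ℕ) (B! : Unique B) (L : ℕ) .{{_ : NonZero L}} (B<L : All (_< L) B) where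

  fresh : ℕ → List ℕ → List ℕ
  fresh s []         = B
  fresh s (v ∷ prev) = filter (λ b → ¬? (s ≟ v + b)) (fresh s prev)

  fresh-unique : ∀ s prev → Unique (fresh s prev)
  fresh-unique s []         = B!
  fresh-unique s (v ∷ prev) = Unique.filter⁺ _ (fresh-unique s prev)

  fresh-all : ∀ {P : ℕ → Set} s prev → All P B → All P (fresh s prev)
  fresh-all s []         PB = PB
  fresh-all s (v ∷ prev) PB = All.filter⁺ _ (fresh-all s prev PB)

  fresh-avoids : ∀ {s v} prev → v ∈ prev → All (λ b → s ≢ v + b) (fresh s prev)
  fresh-avoids {s} (v ∷ prev) (here refl)    = All.all-filter (λ b → ¬? (s ≟ v + b)) (fresh s prev)
  fresh-avoids     (_ ∷ prev) (there v∈prev) = All.filter⁺ _ (fresh-avoids prev v∈prev)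

  length-fresh : ∀ s prev → length B ≤ length (fresh s prev) + length prev
  length-fresh s []         = ≤-reflexive (sym (+-identityʳ (length B)))
  length-fresh s (v ∷ prev) = begin
    length B                                        ≤⟨ length-fresh s prev ⟩
    length (fresh s prev) + length prev             ≤⟨ +-monoˡ-≤ (length prev) at-most-one-removed ⟩
    suc (length (fresh s (v ∷ prev))) + length prev ≡⟨ +-suc _ (length prev) ⟨
    length (fresh s (v ∷ prev)) + suc (length prev) ∎
    where
    open ≤-Reasoning
    at-most-one-removed : length (fresh s prev) ≤ suc (length (fresh s (v ∷ prev)))
    at-most-one-removed = length≤1+length-filter (λ b → ¬? (s ≟ v + b)) (fresh s prev) (fresh-unique s prev)
      (λ {b} ¬¬s≡v+b → trans (sym (m+n∸m≡n v b))
                             (cong (_∸ v) (sym (decidable-stable (s ≟ v + b) ¬¬s≡v+b))))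

  fresh-below : ∀ s prev → L ≤ s → All (_≤ s) (fresh s prev)
  fresh-below s prev L≤s = fresh-all s prev (All.map (λ b<L → ≤-trans (<⇒≤ b<L) L≤s) B<L)

  -- Keeping S inside [L, 2L) makes s ∸ b an honest difference (b < L ≤ s), and one below 2L.
  Window : ℕ → Set
  Window s = L ≤ s × s < L + L

  values : List ℕ → List ℕ → List ℕ
  values prev = concatMap (λ s → map (s ∸_) (fresh s prev))

  length-values : ∀ β prev S → β + length prev ≤ length B → length S * β ≤ length (values prev S)
  length-values β prev []      _ = z≤n
  length-values β prev (s ∷ S) β+prev≤B = begin
    β + length S * β                                    ≤⟨ +-mono-≤ β≤fresh (length-values β prev S β+prev≤B) ⟩
    length (fresh s prev) + length (values prev S)      ≡⟨ cong (_+ length (values prev S))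
                                                             (List.length-map (s ∸_) (fresh s prev)) ⟨
    length (map (s ∸_) (fresh s prev)) + length (values prev S) ≡⟨ List.length-++ (map (s ∸_) (fresh s prev)) ⟨
    length (values prev (s ∷ S))                        ∎
    where
    open ≤-Reasoning
    β≤fresh : β ≤ length (fresh s prev)
    β≤fresh = +-cancelʳ-≤ (length prev) β _ (≤-trans β+prev≤B (length-fresh s prev))

  values-bounded : ∀ prev S → All Window S → All (_< L + L) (values prev S)
  values-bounded prev []      []                 = []
  values-bounded prev (s ∷ S) ((_ , s<2L) ∷ S∈W) =
    All.++⁺ (All.map⁺ (All.universal (λ b → ≤-<-trans (m∸n≤m s b) s<2L) (fresh s prev)))
            (values-bounded prev S S∈W)

  values-avoid : ∀ {v} prev S → All Window S → v ∈ prev → All (_≢ v) (values prev S)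
  values-avoid prev []      []                v∈prev = []
  values-avoid prev (s ∷ S) ((L≤s , _) ∷ S∈W) v∈prev = All.++⁺
    (All.map⁺ (All.zipWith
      (λ (b≤s , s≢v+b) s∸b≡v → s≢v+b (trans (sym (m∸n+n≡m b≤s)) (cong (_+ _) s∸b≡v)))
      (fresh-below s prev L≤s , fresh-avoids prev v∈prev)))
    (values-avoid prev S S∈W v∈prev)

  occurrences-in-row≤1 : ∀ {s v} prev → L ≤ s → length (fibre id v (map (s ∸_) (fresh s prev))) ≤ 1
  occurrences-in-row≤1 {s} {v} prev L≤s = begin
    length (fibre id v (map (s ∸_) (fresh s prev))) ≡⟨ length-filter-map (_≟ v) (s ∸_) (fresh s prev) ⟩
    length (filter (λ b → s ∸ b ≟ v) (fresh s prev)) ≤⟨ unique∧constant⇒length≤1 _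
      (Unique.filter⁺ _ (fresh-unique s prev))
      (All.zipWith (λ (s∸b≡v , b≤s) → trans (sym (m∸[m∸n]≡n b≤s)) (cong (s ∸_) s∸b≡v))
        (All.all-filter (λ b → s ∸ b ≟ v) (fresh s prev) ,
         All.filter⁺ (λ b → s ∸ b ≟ v) (fresh-below s prev L≤s))) ⟩
    1 ∎
    where open ≤-Reasoning

  occurrences-in-row≡0 : ∀ {s v} prev → L ≤ s → ¬ (s - v ∈ B) →
    length (fibre id v (map (s ∸_) (fresh s prev))) ≡ 0
  occurrences-in-row≡0 {s} {v} prev L≤s s-v∉B = trans (length-filter-map (_≟ v) (s ∸_) (fresh s prev))
    (cong length (List.filter-none (λ b → s ∸ b ≟ v) (All.zipWith
      (λ (b≤s , s≢v+b) s∸b≡v → s≢v+b (trans (sym (m∸n+n≡m b≤s)) (cong (_+ _) s∸b≡v)))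
      (fresh-below s prev L≤s , fresh-all s prev (All.¬Any⇒All¬ B s-v∉B)))))

  occurrences-in-values : ∀ {v} prev S → All Window S →
    length (fibre id v (values prev S)) ≤ length (filter (λ s → s - v ∈? B) S)
  occurrences-in-values     prev []      []                 = z≤n
  occurrences-in-values {v} prev (s ∷ S) ((L≤s , _) ∷ S∈W)
    rewrite length-filter-++ (_≟ v) (map (s ∸_) (fresh s prev)) (values prev S)
    with s - v ∈? B
  ... | yes _     = +-mono-≤ (occurrences-in-row≤1 prev L≤s) (occurrences-in-values prev S S∈W)
  ... | no s-v∉B rewrite occurrences-in-row≡0 prev L≤s s-v∉B = occurrences-in-values prev S S∈W

  -- Pigeonhole on the differences s ∸ b (s ∈ S, b ∈ fresh s prev): there are at least β per s,
  -- each value occurs at most once per s and only if s − v ∈ B, and no value lies in prev.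
  extend : ∀ β prev S → All Window S → β + length prev ≤ length B → 1 ≤ length S * β →
    ∃[ v ] (v ∉ prev × length S * β ≤ (L + L) * length (filter (λ s → s - v ∈? B) S))
  extend β prev S S∈W β+prev≤B 1≤Sβ =
    v , v∉prev , ≤-trans Sβ≤occ (*-monoʳ-≤ (L + L) (occurrences-in-values prev S S∈W))
    where
    popular : ∃[ v ] length (values prev S) ≤ (L + L) * length (fibre id v (values prev S))
    popular = pigeonhole id (L + L) (values prev S) (values-bounded prev S S∈W)
    v : ℕ
    v = proj₁ popular
    Sβ≤occ : length S * β ≤ (L + L) * length (fibre id v (values prev S))
    Sβ≤occ = ≤-trans (length-values β prev S β+prev≤B) (proj₂ popular)
    v∉prev : v ∉ prev
    v∉prev v∈prev = contradiction (≤-trans 1≤Sβ (≤-trans Sβ≤occ (≤-reflexive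
      (trans (cong (λ n → (L + L) * length n) (List.filter-none (_≟ v) (values-avoid prev S S∈W v∈prev)))
             (*-zeroʳ (L + L)))))) λ ()

  module _ (k β : ℕ) (β+k≤B : β + k ≤ length B) where

    -- Invariant: S ⊖ prev ⊆ B.  Each step adds a new element to prev and keeps a share β/2L of S,
    -- so when prev has k elements, S still has at least k.
    iterate : ∀ j prev S → Unique S → All Window S → Unique prev → S ⊖ prev ⊆ B →
      length prev + j ≡ k → (L + L) ^ j * k ≤ length S * β ^ j → ContainsDifferenceSet k B
    iterate zero prev S S! S∈W prev! S⊖prev prev≡k k≤S =
      take k S , prev , Unique.take⁺ k S! , trans (List.length-take k S) (m≤n⇒m⊓n≡m k≤S′) ,
      prev! , trans (sym (+-identityʳ _)) prev≡k , All.take⁺ k S⊖prev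
      where
      k≤S′ : k ≤ length S
      k≤S′ = subst₂ _≤_ (*-identityˡ k) (*-identityʳ (length S)) k≤S
    iterate (suc j) prev S S! S∈W prev! S⊖prev prev+1+j≡k bound =
      iterate j (v ∷ prev) S′ (Unique.filter⁺ _ S!) (All.filter⁺ _ S∈W)
        (All.¬Any⇒All¬ prev v∉prev AllPairs.∷ prev!)
        (All.zipWith (λ (s-v∈B , s⊖prev) → s-v∈B ∷ s⊖prev)
          (All.all-filter (λ s → s - v ∈? B) S , All.filter⁺ _ S⊖prev))
        (trans (sym (+-suc (length prev) j)) prev+1+j≡k) bound′
      where
      instance
        2L≢0 : NonZero (L + L)
        2L≢0 = >-nonZero (≤-trans (>-nonZero⁻¹ L) (m≤m+n L L))
      1≤k : 1 ≤ k
      1≤k = ≤-trans (s≤s z≤n) (≤-trans (m≤n+m (suc j) (length prev)) (≤-reflexive prev+1+j≡k))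
      1≤Sβ : 1 ≤ length S * β
      1≤Sβ = 1≤m*n⇒1≤m (length S * β) (β ^ j) (begin
        1                          ≤⟨ *-mono-≤ (m^n>0 (L + L) (suc j)) 1≤k ⟩
        (L + L) ^ suc j * k        ≤⟨ bound ⟩
        length S * (β * β ^ j)     ≡⟨ *-assoc (length S) β _ ⟨
        length S * β * β ^ j       ∎)
        where open ≤-Reasoning
      prev≤k : length prev ≤ k
      prev≤k = m+n≤o⇒m≤o (length prev) (≤-reflexive prev+1+j≡k)
      step : ∃[ v ] (v ∉ prev × length S * β ≤ (L + L) * length (filter (λ s → s - v ∈? B) S))
      step = extend β prev S S∈W (≤-trans (+-monoʳ-≤ β prev≤k) β+k≤B) 1≤Sβ
      v : ℕ
      v = proj₁ step
      v∉prev : v ∉ prev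
      v∉prev = proj₁ (proj₂ step)
      S′ : List ℕ
      S′ = filter (λ s → s - v ∈? B) S
      bound′ : (L + L) ^ j * k ≤ length S′ * β ^ j
      bound′ = *-cancelˡ-≤ (L + L) (begin
        (L + L) * ((L + L) ^ j * k)   ≡⟨ *-assoc (L + L) _ k ⟨
        (L + L) ^ suc j * k           ≤⟨ bound ⟩
        length S * (β * β ^ j)        ≡⟨ *-assoc (length S) β _ ⟨
        length S * β * β ^ j          ≤⟨ *-monoˡ-≤ (β ^ j) (proj₂ (proj₂ step)) ⟩
        (L + L) * length S′ * β ^ j   ≡⟨ *-assoc (L + L) _ _ ⟩
        (L + L) * (length S′ * β ^ j) ∎)
        where open ≤-Reasoning

    difference-set : (L + L) ^ k * k ≤ L * β ^ k → ContainsDifferenceSet k B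
    difference-set bound = iterate k [] window
      (Unique.map⁺ (+-cancelˡ-≡ L _ _) (Unique.upTo⁺ L))
      (All.map⁺ (All.map (λ {i} i<L → m≤m+n L i , +-monoʳ-< L i<L) (All.all-upTo L)))
      AllPairs.[] (All.universal (λ _ → []) window) refl
      (subst (λ n → (L + L) ^ k * k ≤ n * β ^ k) (sym length-window) bound)
      where
      window : List ℕ
      window = map (L +_) (upTo L)
      length-window : length window ≡ L
      length-window = trans (List.length-map (L +_) (upTo L)) (List.length-upTo L)

  difference-set-free-bound : ∀ k → ¬ ContainsDifferenceSet (suc k) B →
    length B ^ suc k ≤ difference-set-constant (suc k) * L ^ k
  difference-set-free-bound k no-difference-set = by-size (length B ≤? K + K)
    where
    K β c : ℕ
    K = suc k
    β = length B ∸ K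
    c = difference-set-constant K
    open ≤-Reasoning

    β+K≡n : K + K < length B → β + K ≡ length B
    β+K≡n 2K<n = m∸n+n≡m (≤-trans (m≤m+n K K) (<⇒≤ 2K<n))

    large : K + K < length B → Dec ((L + L) ^ K * K ≤ L * β ^ K) → length B ^ K ≤ c * L ^ k
    large 2K<n (yes bound) =
      contradiction (difference-set K β (≤-reflexive (β+K≡n 2K<n)) bound) no-difference-set
    large 2K<n (no ¬bound) = begin
      length B ^ K                  ≤⟨ ^-monoˡ-≤ K n≤β+β ⟩
      (β + β) ^ K                   ≡⟨ cong (_^ K) (m+m≡2*m β) ⟩
      (2 * β) ^ K                   ≡⟨ ^-distrib-* 2 β K ⟩
      2 ^ K * β ^ K                 ≤⟨ *-monoʳ-≤ (2 ^ K) β^K≤ ⟩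
      2 ^ K * (2 ^ K * K * L ^ k)   ≡⟨ *-assoc′ (2 ^ K) (2 ^ K) K (L ^ k) ⟩
      2 ^ K * 2 ^ K * K * L ^ k     ≤⟨ *-monoˡ-≤ (L ^ k) (m≤n+m (2 ^ K * 2 ^ K * K) ((K + K) ^ K)) ⟩
      c * L ^ k                     ∎
      where
      n≤β+β : length B ≤ β + β
      n≤β+β = subst (_≤ β + β) (β+K≡n 2K<n)
        (+-monoʳ-≤ β (+-cancelʳ-≤ K K β (<⇒≤ (subst (K + K <_) (sym (β+K≡n 2K<n)) 2K<n))))
      β^K≤ : β ^ K ≤ 2 ^ K * K * L ^ k
      β^K≤ = *-cancelˡ-≤ L (<⇒≤ (begin-strict
        L * β ^ K                 <⟨ ≰⇒> ¬bound ⟩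
        (L + L) ^ K * K           ≡⟨ cong (λ x → x ^ K * K) (m+m≡2*m L) ⟩
        (2 * L) ^ K * K           ≡⟨ cong (_* K) (^-distrib-* 2 L K) ⟩
        2 ^ K * (L * L ^ k) * K   ≡⟨ rearrange (2 ^ K) L (L ^ k) K ⟩
        L * (2 ^ K * K * L ^ k)   ∎))
        where
        rearrange : ∀ a l m n → a * (l * m) * n ≡ l * (a * n * m)
        rearrange = solve-∀
      *-assoc′ : ∀ a b c d → a * (b * c * d) ≡ a * b * c * d
      *-assoc′ = solve-∀

    by-size : Dec (length B ≤ K + K) → length B ^ K ≤ c * L ^ k
    by-size (yes n≤2K) = begin
      length B ^ K    ≤⟨ ^-monoˡ-≤ K n≤2K ⟩
      (K + K) ^ K     ≤⟨ m≤m+n _ _ ⟩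
      c               ≤⟨ m≤m*n c (L ^ k) {{m^n≢0 L k}} ⟩
      c * L ^ k       ∎
    by-size (no n≰2K) = large (≰⇒> n≰2K) ((L + L) ^ K * K ≤? L * β ^ K)


open DifferenceSet using (difference-set-free-bound)

missing-below : ∀ p (ys : List ℕ) → length ys < p → ∃[ t ] (t < p × t ∉ ys)
missing-below (suc p) ys |ys|≤p with length (filter (¬? ∘ (_≟ p)) ys) <? p
... | yes |ys∖p|<p =
  let t , t<p , t∉ys∖p = missing-below p (filter (¬? ∘ (_≟ p)) ys) |ys∖p|<p
  in t , m≤n⇒m≤1+n t<p , λ t∈ys → t∉ys∖p (∈-filter⁺ (¬? ∘ (_≟ p)) t∈ys (<⇒≢ t<p))
... | no |ys∖p|≮p = p , ≤-refl , λ p∈ys →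
  <⇒≱ (List.filter-notAll (¬? ∘ (_≟ p)) ys (Any.map (λ p≡y p≢y → p≢y (sym p≡y)) p∈ys))
      (≤-trans (≤-pred |ys|≤p) (≮⇒≥ |ys∖p|≮p))

third-residue : ∀ {p} a → 2 ≤ p → (a ≡ 1 → 2 < p) → ∃[ t ] (t < p × t ≢ 0 × t ≢ a)
third-residue a 2≤p a≡1⇒2<p with a ≟ 1
... | yes a≡1 = 2 , a≡1⇒2<p a≡1 , (λ ()) , (λ 2≡a → contradiction (trans 2≡a a≡1) λ ())
... | no  a≢1 = 1 , 2≤p , (λ ()) , (λ 1≡a → a≢1 (sym 1≡a))

InTwoClasses : ℕ → ℕ → ℕ → Set
InTwoClasses Q r x = ∃[ m ] (x ≡ Q * m ⊎ x ≡ Q * m + r)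

two-classes-residues : ∀ {Q r p} .{{_ : NonZero p}} {x} → p ∣ Q → InTwoClasses Q r x →
  x % p ≡ 0 ⊎ x % p ≡ r % p
two-classes-residues {p = p} p∣Q (m , inj₁ refl) = inj₁ (n∣m⇒m%n≡0 _ p (∣-trans p∣Q (m∣m*n m)))
two-classes-residues {r = r} p∣Q (m , inj₂ refl) = inj₂ (%-remove-+ˡ r (∣-trans p∣Q (m∣m*n m)))

two-classes-admissible : ∀ {n Q r} → (∀ p → Prime p → p ≤ n → p ∣ Q) → 2 ∣ r →
  ∀ xs → length xs ≤ n → All (InTwoClasses Q r) xs → Admissible xs
two-classes-admissible {n} {Q} {r} small-primes∣Q 2∣r xs |xs|≤n classes p p-prime with p ∣? Q
... | no p∤Q =
  let t , t<p , t∉xs%p = missing-below p (map (_% p) xs)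
                           (subst (_< p) (sym (List.length-map (_% p) xs)) |xs|<p)
  in t , t<p , All.map⁻ (All.map (λ t≢x%p x%p≡t → t≢x%p (sym x%p≡t)) (All.¬Any⇒All¬ _ t∉xs%p))
  where
  instance _ = prime⇒nonZero p-prime
  |xs|<p : length xs < p
  |xs|<p = ≤-<-trans |xs|≤n (≰⇒> (p∤Q ∘ small-primes∣Q p p-prime))
... | yes p∣Q =
  let t , t<p , t≢0 , t≢r%p = third-residue (r % p) 2≤p r%p≡1⇒2<p
  in t , t<p , All.map (λ x-class x%p≡t →
       [ (λ x%p≡0 → t≢0 (trans (sym x%p≡t) x%p≡0)) , (λ x%p≡r → t≢r%p (trans (sym x%p≡t) x%p≡r)) ]′
       (two-classes-residues p∣Q x-class)) classes
  where
  instance _ = prime⇒nonZero p-prime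
  2≤p : 2 ≤ p
  2≤p = nonTrivial⇒n>1 p {{prime⇒nonTrivial p-prime}}
  r%p≡1⇒2<p : r % p ≡ 1 → 2 < p
  r%p≡1⇒2<p r%p≡1 = ≤∧≢⇒< 2≤p λ { refl → contradiction (trans (sym (n∣m⇒m%n≡0 r 2 2∣r)) r%p≡1) λ () }

module _ {𝒟 : ℕ → Set} {k : ℕ} (cross : CrossProduct 𝒟 k)
         (Q : ℕ) .{{_ : NonZero Q}} (2∣Q : 2 ∣ Q) (small-primes∣Q : ∀ p → Prime p → p ≤ k + k → p ∣ Q)
         (r : ℕ) (2∣r : 2 ∣ r) where

  cross-product⇒no-difference-set : ∀ B → All (λ b → 1 ≤ r + b * Q × ¬ 𝒟 (r + b * Q)) B →
    ¬ ContainsDifferenceSet k B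
  cross-product⇒no-difference-set B good (U , V , U! , |U|≡k , V! , |V|≡k , U⊖V⊆B) =
    refute (cross U′ V′ U′! V′! |U′|≡k |V′|≡k U′-pos-even V′-pos-even disjoint admissible)
    where
    lift-V lift-U : ℕ → ℕ
    lift-V v = Q * suc v
    lift-U u = lift-V u + r
    U′ V′ : List ℕ
    U′ = map lift-U U
    V′ = map lift-V V

    -- Q(u + 1) + r − Q(v + 1) = r + (u − v)Q: every cross difference is one of the r + bQ.
    gap : ∀ {u v} → u ∈ U → v ∈ V → ∃[ b ] (b ∈ B × lift-U u ≡ lift-V v + (r + b * Q))
    gap {u} {v} u∈U v∈V with find (All.lookup (All.lookup U⊖V⊆B u∈U) v∈V)
    ... | b , b∈B , refl = b , b∈B , shift Q v b r
      where
      shift : ∀ Q v b r → Q * suc (v + b) + r ≡ Q * suc v + (r + b * Q)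
      shift = solve-∀

    refute : ∃[ u′ ] ∃[ v′ ] (u′ ∈ U′ × v′ ∈ V′ × 𝒟 ∣ u′ - v′ ∣) → ⊥
    refute (u′ , v′ , u′∈U′ , v′∈V′ , 𝒟u′v′) with ∈-map⁻ lift-U u′∈U′ | ∈-map⁻ lift-V v′∈V′
    ... | u , u∈U , refl | v , v∈V , refl with gap u∈U v∈V
    ... | b , b∈B , u′≡v′+a = proj₂ (All.lookup good b∈B) (subst 𝒟 distance 𝒟u′v′)
      where
      open ≡-Reasoning
      distance : ∣ lift-U u - lift-V v ∣ ≡ r + b * Q
      distance = begin
        ∣ lift-U u - lift-V v ∣               ≡⟨ cong (λ x → ∣ x - lift-V v ∣) u′≡v′+a ⟩
        ∣ lift-V v + (r + b * Q) - lift-V v ∣ ≡⟨ ∣-∣-comm (lift-V v + (r + b * Q)) (lift-V v) ⟩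
        ∣ lift-V v - lift-V v + (r + b * Q) ∣ ≡⟨ ∣m-m+n∣≡n (lift-V v) (r + b * Q) ⟩
        r + b * Q                             ∎

    U′! : Unique U′
    U′! = Unique.map⁺ (λ {x} {y} eq → suc-injective (*-cancelˡ-≡ (suc x) (suc y) Q (+-cancelʳ-≡ r _ _ eq))) U!
    V′! : Unique V′
    V′! = Unique.map⁺ (λ {x} {y} eq → suc-injective (*-cancelˡ-≡ (suc x) (suc y) Q eq)) V!
    |U′|≡k : length U′ ≡ k
    |U′|≡k = trans (List.length-map lift-U U) |U|≡k
    |V′|≡k : length V′ ≡ k
    |V′|≡k = trans (List.length-map lift-V V) |V|≡k

    lift-V-pos-even : ∀ v → PosEven (lift-V v)
    lift-V-pos-even v = ≤-trans (>-nonZero⁻¹ Q) (m≤m*n Q (suc v)) , ∣m⇒∣m*n (suc v) 2∣Q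
    U′-pos-even : All PosEven U′
    U′-pos-even = All.map⁺ (All.universal (λ u → let pos , even = lift-V-pos-even u in
                    ≤-trans pos (m≤m+n _ r) , ∣m∣n⇒∣m+n even 2∣r) U)
    V′-pos-even : All PosEven V′
    V′-pos-even = All.map⁺ (All.universal lift-V-pos-even V)

    disjoint : Disjoint U′ V′
    disjoint x x∈U′ x∈V′ with ∈-map⁻ lift-U x∈U′ | ∈-map⁻ lift-V x∈V′
    ... | u , u∈U , refl | v , v∈V , x≡v′ with gap u∈U v∈V
    ... | b , b∈B , u′≡v′+a = <-irrefl (trans (sym x≡v′) u′≡v′+a)
                                (m<m+n (lift-V v) (proj₁ (All.lookup good b∈B)))

    admissible : Admissible (U′ ++ V′)
    admissible = two-classes-admissible small-primes∣Q 2∣r (U′ ++ V′)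
      (≤-reflexive (trans (List.length-++ U′) (cong₂ _+_ |U′|≡k |V′|≡k)))
      (All.++⁺ (All.map⁺ (All.universal (λ u → suc u , inj₂ refl) U))
               (All.map⁺ (All.universal (λ v → suc v , inj₁ refl) V)))

¬CrossProduct-zero : ∀ {𝒟} → ¬ CrossProduct 𝒟 0
¬CrossProduct-zero cross with cross [] [] AllPairs.[] AllPairs.[] refl refl [] [] (λ _ ()) admissible
  where
  admissible : Admissible []
  admissible p p-prime = 0 , ≤-trans (s≤s z≤n) (nonTrivial⇒n>1 p {{prime⇒nonTrivial p-prime}}) , []
... | _ , _ , () , _

quotients-unique : ∀ Q .{{_ : NonZero Q}} {r} xs → Unique xs → All (λ x → x % Q ≡ r) xs →
  Unique (map (_/ Q) xs)
quotients-unique Q []       AllPairs.[]           []                 = AllPairs.[]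
quotients-unique Q (x ∷ xs) (x∉xs AllPairs.∷ xs!) (x%Q≡r ∷ xs%Q≡r) =
  All.map⁺ (All.zipWith (λ { {y} (x≢y , y%Q≡r) x/Q≡y/Q → x≢y (begin
      x                    ≡⟨ m≡m%n+[m/n]*n x Q ⟩
      x % Q + x / Q * Q    ≡⟨ cong₂ (λ a b → a + b * Q) (trans x%Q≡r (sym y%Q≡r)) x/Q≡y/Q ⟩
      y % Q + y / Q * Q    ≡⟨ m≡m%n+[m/n]*n y Q ⟨
      y                    ∎) }) (x∉xs , xs%Q≡r))
  AllPairs.∷ quotients-unique Q xs xs! xs%Q≡r
  where open ≡-Reasoning

module ExceptionalBound (k : ℕ) (cross : CrossProduct DePolignac (suc k)) where

  K Q c C : ℕ
  K = suc k
  Q = (K + K) !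
  c = difference-set-constant K
  C = Q ^ K * (c * 2 ^ k)

  instance
    Q≢0 : NonZero Q
    Q≢0 = >-nonZero (1≤n! (K + K))

  small-primes∣Q : ∀ p → Prime p → p ≤ K + K → p ∣ Q
  small-primes∣Q p p-prime = ∣n! {n = K + K} (≤-trans (s≤s z≤n) (nonTrivial⇒n>1 p {{prime⇒nonTrivial p-prime}}))

  2∣Q : 2 ∣ Q
  2∣Q = ∣n! {n = K + K} (s≤s z≤n) (+-mono-≤ (s≤s z≤n) (s≤s z≤n))

  no-exceptional-difference-set : ∀ N r A → All (Exceptional N) A → All (λ a → a % Q ≡ r) A →
    ¬ ContainsDifferenceSet K (map (_/ Q) A)
  no-exceptional-difference-set N r A exceptional A≡r D =
    cross-product⇒no-difference-set {DePolignac} cross Q 2∣Q small-primes∣Q r r-even (map (_/ Q) A)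
      (All.map⁺ (All.zipWith (λ (a%Q≡r , 1≤a , _ , _ , ¬dp) →
         subst (λ a → 1 ≤ a × ¬ DePolignac a) (a≡r+[a/Q]*Q a%Q≡r) (1≤a , ¬dp)) (A≡r , exceptional)))
      D
    where
    a≡r+[a/Q]*Q : ∀ {a} → a % Q ≡ r → a ≡ r + a / Q * Q
    a≡r+[a/Q]*Q {a} a%Q≡r = trans (m≡m%n+[m/n]*n a Q) (cong (_+ a / Q * Q) a%Q≡r)
    r-even : 2 ∣ r
    r-even with difference-set-element D
    ... | _ , b∈B with ∈-map⁻ (_/ Q) b∈B
    ... | a , a∈A , _ = subst (2 ∣_) (All.lookup A≡r a∈A)
                          (%-presˡ-∣ (proj₁ (proj₂ (proj₂ (All.lookup exceptional a∈A)))) 2∣Q)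

  exceptional-bound : ∀ N xs → Unique xs → All (Exceptional N) xs → length xs ^ K ≤ C * N ^ k
  exceptional-bound zero      []      _   _                      = z≤n
  exceptional-bound zero      (_ ∷ _) _   ((1≤x , x≤0 , _) ∷ _) = contradiction x≤0 (<⇒≱ 1≤x)
  exceptional-bound N@(suc _) xs      xs! exceptional = begin
    length xs ^ K                  ≤⟨ ^-monoˡ-≤ K xs≤QB ⟩
    (Q * length B) ^ K             ≡⟨ ^-distrib-* Q (length B) K ⟩
    Q ^ K * length B ^ K           ≤⟨ *-monoʳ-≤ (Q ^ K) B^K≤ ⟩
    Q ^ K * (c * suc N ^ k)        ≤⟨ *-monoʳ-≤ (Q ^ K) (*-monoʳ-≤ c (suc-n^k≤2^k*n^k N k (s≤s z≤n))) ⟩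
    Q ^ K * (c * (2 ^ k * N ^ k))  ≡⟨ reassociate (Q ^ K) c (2 ^ k) (N ^ k) ⟩
    C * N ^ k                      ∎
    where
    open ≤-Reasoning
    reassociate : ∀ a b d e → a * (b * (d * e)) ≡ a * (b * d) * e
    reassociate = solve-∀
    residue-class : ∃[ r ] length xs ≤ Q * length (fibre (_% Q) r xs)
    residue-class = pigeonhole (_% Q) Q xs (All.universal (λ x → m%n<n x Q) xs)
    r : ℕ
    r = proj₁ residue-class
    A B : List ℕ
    A = fibre (_% Q) r xs
    B = map (_/ Q) A
    xs≤QB : length xs ≤ Q * length B
    xs≤QB = subst (λ n → length xs ≤ Q * n) (sym (List.length-map (_/ Q) A)) (proj₂ residue-class)
    A≡r : All (λ a → a % Q ≡ r) A
    A≡r = All.all-filter (λ x → x % Q ≟ r) xs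
    A-exceptional : All (Exceptional N) A
    A-exceptional = All.filter⁺ (λ x → x % Q ≟ r) exceptional
    B<L : All (_< suc N) B
    B<L = All.map⁺ (All.map (λ {a} (_ , a≤N , _) → s≤s (≤-trans (m/n≤m a Q) a≤N)) A-exceptional)
    B^K≤ : length B ^ K ≤ c * suc N ^ k
    B^K≤ = difference-set-free-bound B (quotients-unique Q A (Unique.filter⁺ (λ x → x % Q ≟ r) xs!) A≡r)
             (suc N) B<L k (no-exceptional-difference-set N r A A-exceptional A≡r)

lemma4p1 : (k : ℕ) → CrossProduct DePolignac k →
    ((d : ℕ) → 1 ≤ d → ∃[ N₀ ] ((N : ℕ) → N₀ ≤ N →
        CountSatisfies (Exceptional N) (λ c → c * d ≤ N)))
    × (∃[ p ] ∃[ q ] ∃[ C ] (p < q × ((N : ℕ) →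
        CountSatisfies (Exceptional N) (λ c → c ^ q ≤ C * N ^ p))))
lemma4p1 zero    cross = contradiction cross (¬CrossProduct-zero {DePolignac})
lemma4p1 (suc k) cross =
  (λ d _ → suc (C * d ^ suc k) , λ N Cd^K<N xs xs! exceptional →
     power-bound⇒linear-bound {k} {C} (length xs) d (exceptional-bound N xs xs! exceptional) Cd^K<N) ,
  (k , suc k , C , ≤-refl , exceptional-bound)
  where open ExceptionalBound k cross
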